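{- Let $G$ be a connected graph, let $T$ be a tree set of separations of $G$, let $O$ be a consistent orientation of $T$ with part $\Pi$, and suppose that $G[\Pi]$ coincides with the torso of $O$. If $\omega$ is an end of $G$ lying in the closure of $\Pi$, then $\omega$ has a ray contained in $G[\Pi]$.
   Context: A separation of $G=(V,E)$ is $\{A,B\}$ with $A\cup B=V$ and no edge between $A\setminus B$ and $B\setminus A$; orientations $(A,B),(B,A)$ (mutually inverse) ordered by $(A,B)\le(C,D)$ iff $A\subseteq C$, $B\supseteq D$. A tree set is a set $T$ of separations any two of which have comparable orientations, with no orientation $\vec r$ that is degenerate ($\vec r=\overleftarrow r$) or trivial (there is $s\in T$, $s\ne r$, with $\vec r<\vec s$ and $\vec r<\overleftarrow s$). An orientation $O$ of $T$ contains exactly one orientation of each separation of $T$; it is consistent if there are no distinct $r,s$ with orientations $\vec r<\vec s$ and $\overleftarrow r,\vec s\in O$. The part of $O$ is $\Pi=\bigcap\{B:(A,B)\in O\}$; the torso of $O$ is obtained from $G[\Pi]$ by adding an edge $xy$ for all distinct $x,y\in\Pi$ lying together in the separator $A\cap B$ of some $(A,B)\in O$. An end of $G$ is an equivalence class of rays, where two rays are equivalent if for every finite $X\subseteq V$ they have tails in the same component of $G-X$; $C(X,\omega)$ is that component for the rays of $\omega$. An end $\omega$ lies in the closure of a vertex set $M$ if $C(X,\omega)$ meets $M$ for every finite $X\subseteq V$. -}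

module Defs where

open import Level using (0ℓ)
open import Data.Nat using (ℕ; suc; _≤_)
open import Data.Bool using (Bool; true; false)
open import Data.Product using (Σ; ∃; ∃-syntax; _×_; _,_; proj₁; proj₂)
open import Data.Sum using (_⊎_)
open import Data.List using (List)
open import Data.List.Membership.Propositional using (_∈_)
open import Relation.Nullary using (¬_)
open import Relation.Binary.PropositionalEquality using (_≡_)
open import Function.Definitions using (Injective)

record Graph : Set₁ where
  field
    V      : Set
    _~_    : V → V → Set
    ~-sym  : ∀ {x y} → x ~ y → y ~ x
    ~-irr  : ∀ {x} → ¬ (x ~ x)

VSet : Graph → Set₁
VSet G = Graph.V G → Set

module _ (G : Graph) where
  open Graph G

  data WalkAvoid (X : List V) : V → V → Set where
    here : ∀ {v} → ¬ (v ∈ X) → WalkAvoid X v v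
    step : ∀ {u w v} → ¬ (u ∈ X) → u ~ w → WalkAvoid X w v → WalkAvoid X u v

  Connected : Set
  Connected = ∀ u v → WalkAvoid Data.List.[] u v

  -- A separation, given by one of its orientations (A , B).
  record Sep : Set₁ where
    constructor sep
    field
      A     : VSet G
      B     : VSet G
      cover : ∀ v → A v ⊎ B v
      noEdge : ∀ {x y} → A x → ¬ B x → B y → ¬ A y → ¬ (x ~ y)

  open Sep public

  inv : Sep → Sep
  inv (sep A B c n) = sep B A (λ v → Data.Sum.swap (c v))
                            (λ bx ¬ax ay ¬by e → n ay ¬by bx ¬ax (~-sym e))

  _⊆_ : VSet G → VSet G → Set
  P ⊆ Q = ∀ v → P v → Q v

  _≤ₛ_ : Sep → Sep → Set
  s ≤ₛ t = (A s ⊆ A t) × (B t ⊆ B s)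

  _≈ₛ_ : Sep → Sep → Set
  s ≈ₛ t = (s ≤ₛ t) × (t ≤ₛ s)

  _<ₛ_ : Sep → Sep → Set
  s <ₛ t = (s ≤ₛ t) × ¬ (s ≈ₛ t)

  -- A set T of (unoriented) separations, presented as a family indexed by I;
  -- each index i stands for the separation {A,B} with chosen orientation
  -- sepOf i.
  record SepSet : Set₁ where
    field
      I       : Set
      sepOf   : I → Sep
      distinct : ∀ i j → (sepOf i ≈ₛ sepOf j) ⊎ (sepOf i ≈ₛ inv (sepOf j)) → i ≡ j

  module _ (T : SepSet) where
    open SepSet T

    orient : I → Bool → Sep
    orient i true  = sepOf i
    orient i false = inv (sepOf i)

    -- tree set: nested, no degenerate and no trivial orientations
    IsTreeSet : Set
    IsTreeSet =
        (∀ i j → ∃[ b ] ∃[ c ] (orient i b ≤ₛ orient j c))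
      × (∀ i b → ¬ (orient i b ≈ₛ inv (orient i b)))
      × (∀ i b → ¬ (∃[ j ] ∃[ c ] (¬ (i ≡ j) × (orient i b <ₛ orient j c)
                                           × (orient i b <ₛ inv (orient j c)))))

    Orientation : Set
    Orientation = I → Bool

    module _ (O : Orientation) where
      chosen : I → Sep
      chosen i = orient i (O i)

      Consistent : Set
      Consistent = ∀ i j b → ¬ (¬ (i ≡ j)
                                  × (orient i b <ₛ chosen j)
                                  × (inv (orient i b) ≈ₛ chosen i))

      Part : VSet G
      Part v = ∀ i → B (chosen i) v

      InducedAdj : V → V → Set
      InducedAdj x y = Part x × Part y × (x ~ y)

      TorsoAdj : V → V → Set
      TorsoAdj x y = Part x × Part y ×
        ((x ~ y) ⊎ (¬ (x ≡ y) × ∃[ i ] ((A (chosen i) x × B (chosen i) x)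
                                        × (A (chosen i) y × B (chosen i) y))))

      TorsoIsInduced : Set
      TorsoIsInduced = ∀ x y → (InducedAdj x y → TorsoAdj x y)
                              × (TorsoAdj x y → InducedAdj x y)

  record Ray : Set where
    field
      vert : ℕ → V
      inj  : Injective _≡_ _≡_ vert
      adj  : ∀ n → vert n ~ vert (suc n)

  open Ray public

  SameComp : List V → Ray → Ray → Set
  SameComp X r s = ∃[ m ] ∃[ n ]
      (∀ k → m ≤ k → ¬ (vert r k ∈ X))
    × (∀ k → n ≤ k → ¬ (vert s k ∈ X))
    × WalkAvoid X (vert r m) (vert s n)

  -- Equivalence of rays; an end is an equivalence class, represented by
  -- any of its rays.
  Equiv : Ray → Ray → Set
  Equiv r s = ∀ (X : List V) → SameComp X r s

  InComp : List V → Ray → V → Set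
  InComp X r v = ∃[ m ] (∀ k → m ≤ k → ¬ (vert r k ∈ X))
                      × WalkAvoid X (vert r m) v

  InClosure : Ray → VSet G → Set
  InClosure r M = ∀ (X : List V) → ∃[ v ] (M v × InComp X r v)

  HasRayIn : Ray → VSet G → Set
  HasRayIn r M = ∃[ s ] (Equiv r s × (∀ n → M (vert s n)))

module Submission where

-- The key fact is TorsoShortcuts.shortcut: a walk between two vertices of Π contains the
-- vertices of a walk inside Π. Where the walk leaves Π at u it runs, by the nestedness of the
-- tree set, strictly inside the small side of a chosen separation whose separator contains u
-- (the relation Linked), so it returns to Π at u or at a vertex w of that separator; uw is then
-- an edge of the torso, hence of G.
--
-- A stage holds a finite set F of used vertices, the
-- current end x ∈ Π and a walk W avoiding F from a tail of ω to x. As ω lies in the closure of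
-- Π, some y ∈ Π is reached from a later tail of ω avoiding F and W; the detour from x to y is
-- rerouted into Π and cut where a walk from a still later tail of ω first meets it. This gives a
-- new path Q ⊆ Π avoiding F and the next connecting walk. The paths Q concatenate to a ray
-- (Rays.Concatenation), and the walks W are infinitely many disjoint connections between ω and
-- that ray, so the two are equivalent (Rays.connected⇒equivalent).
--
-- Excluded middle is used to decide
-- membership of vertices in sets and to find the separation showing that a vertex is not in Π.

open import Defs
open import Level using (0ℓ)
open import Axiom.ExcludedMiddle using (ExcludedMiddle)
open import Axiom.DoubleNegationElimination using (em⇒dne)
open import Data.Nat using (ℕ; zero; suc; _+_; _∸_; _≤_; _<_; _≤′_; ≤′-refl; ≤′-step; z≤n; s≤s; _≤?_)
open import Data.Nat.Properties
open import Data.Bool using (true; false)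
open import Data.Product using (Σ; ∃; ∃-syntax; _×_; _,_; proj₁; proj₂)
open import Data.Sum using (_⊎_; inj₁; inj₂; [_,_]′)
open import Data.List using (List; []; _∷_; _++_)
open import Data.List.Membership.Propositional using (_∈_; _∉_)
open import Data.List.Membership.Propositional.Properties using (∈-++⁺ˡ; ∈-++⁺ʳ; ∈-++⁻)
open import Data.List.Relation.Unary.Any using (here; there)
open import Data.List.Relation.Unary.All using ([]; _∷_)
open import Data.List.Relation.Unary.AllPairs using ([]; _∷_) renaming (tail to unique-tail)
open import Data.List.Relation.Unary.All.Properties using (¬Any⇒All¬)
open import Data.List.Relation.Unary.Unique.Propositional using (Unique)
open import Data.List.Relation.Unary.Unique.Propositional.Properties using (Unique[x∷xs]⇒x∉xs)
open import Data.List.Relation.Binary.Subset.Propositional using () renaming (_⊆_ to _⊆ᴸ_)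
open import Data.Empty using (⊥-elim)
open import Function using (_∘_)
open import Relation.Nullary using (¬_; yes; no)
open import Relation.Binary.Definitions using (tri<; tri≈; tri>)
open import Relation.Binary.PropositionalEquality using (_≡_; refl; sym; trans; cong; subst)

increasing-⊆ : ∀ {A : Set} (L : ℕ → List A) → (∀ n → L n ⊆ᴸ L (suc n)) → ∀ {m n} → m ≤′ n → L m ⊆ᴸ L n
increasing-⊆ L grows ≤′-refl          = λ x∈ → x∈
increasing-⊆ L grows (≤′-step m≤′n) = grows _ ∘ increasing-⊆ L grows m≤′n

strictly-increasing : (f : ℕ → ℕ) → (∀ n → f n < f (suc n)) → ∀ n → n ≤ f n
strictly-increasing f increases zero    = z≤n
strictly-increasing f increases (suc n) =
  ≤-trans (s≤s (strictly-increasing f increases n)) (increases n)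

module Walks (G : Graph) where
  open Graph G

  data Walk : V → V → Set where
    nil  : ∀ v → Walk v v
    cons : ∀ {u w v} → u ~ w → Walk w v → Walk u v

  verts : ∀ {a b} → Walk a b → List V
  verts (nil v)        = v ∷ []
  verts (cons {u} _ p) = u ∷ verts p

  initv : ∀ {a b} → Walk a b → List V
  initv (nil _)        = []
  initv (cons {u} _ p) = u ∷ initv p

  len : ∀ {a b} → Walk a b → ℕ
  len (nil _)    = 0
  len (cons _ p) = suc (len p)

  Every : (V → Set) → ∀ {a b} → Walk a b → Set
  Every P p = ∀ {v} → v ∈ verts p → P v

  Avoids : List V → ∀ {a b} → Walk a b → Set
  Avoids X = Every (_∉ X)

  start∈ : ∀ {a b} (p : Walk a b) → a ∈ verts p
  start∈ (nil _)    = here refl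
  start∈ (cons _ _) = here refl

  end∈ : ∀ {a b} (p : Walk a b) → b ∈ verts p
  end∈ (nil _)    = here refl
  end∈ (cons _ p) = there (end∈ p)

  start∷⊆ : ∀ {a b} (p : Walk a b) → a ∷ verts p ⊆ᴸ verts p
  start∷⊆ p (here refl) = start∈ p
  start∷⊆ p (there x∈)  = x∈

  initv⊆verts : ∀ {a b} (p : Walk a b) → initv p ⊆ᴸ verts p
  initv⊆verts (cons _ p) (here refl) = here refl
  initv⊆verts (cons _ p) (there v∈) = there (initv⊆verts p v∈)

  len≡0 : ∀ {a b} (p : Walk a b) → len p ≡ 0 → a ≡ b
  len≡0 (nil _) _ = refl

  end∉initv : ∀ {a b} (p : Walk a b) → Unique (verts p) → b ∉ initv p
  end∉initv (cons _ p) u (here refl)  = Unique[x∷xs]⇒x∉xs u (end∈ p)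
  end∉initv (cons _ p) (_ ∷ u) (there b∈) = end∉initv p u b∈

  _++w_ : ∀ {a b c} → Walk a b → Walk b c → Walk a c
  nil _    ++w q = q
  cons e p ++w q = cons e (p ++w q)

  ∈-++w⁻ : ∀ {a b c x} (p : Walk a b) (q : Walk b c) →
           x ∈ verts (p ++w q) → x ∈ verts p ⊎ x ∈ verts q
  ∈-++w⁻ (nil _)    q x∈           = inj₂ x∈
  ∈-++w⁻ (cons e p) q (here refl)  = inj₁ (here refl)
  ∈-++w⁻ (cons e p) q (there x∈) with ∈-++w⁻ p q x∈
  ... | inj₁ x∈p = inj₁ (there x∈p)
  ... | inj₂ x∈q = inj₂ x∈q

  every-++w : ∀ {P a b c} (p : Walk a b) (q : Walk b c) →
              Every P p → Every P q → Every P (p ++w q)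
  every-++w p q Pp Pq x∈ = [ Pp , Pq ]′ (∈-++w⁻ p q x∈)

  every-⊆ : ∀ {P a b c d} {p : Walk a b} {q : Walk c d} →
            verts q ⊆ᴸ verts p → Every P p → Every P q
  every-⊆ q⊆p Pp x∈ = Pp (q⊆p x∈)

  avoids-++ : ∀ {X Z a b} {p : Walk a b} → Avoids X p → Avoids Z p → Avoids (X ++ Z) p
  avoids-++ {X} X-avoids Z-avoids v∈ v∈XZ = [ X-avoids v∈ , Z-avoids v∈ ]′ (∈-++⁻ X v∈XZ)

  reverse : ∀ {a b} → Walk a b → Walk b a
  reverse (nil v)        = nil v
  reverse (cons {u} e p) = reverse p ++w cons (~-sym e) (nil u)

  verts-reverse : ∀ {a b} (p : Walk a b) → verts (reverse p) ⊆ᴸ verts p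
  verts-reverse (nil v) x∈ = x∈
  verts-reverse (cons {u} e p) x∈ with ∈-++w⁻ (reverse p) (cons (~-sym e) (nil u)) x∈
  ... | inj₁ x∈p                = there (verts-reverse p x∈p)
  ... | inj₂ (here refl)        = there (start∈ p)
  ... | inj₂ (there (here refl)) = here refl

  fromAvoid : ∀ {X a b} → WalkAvoid G X a b → Σ (Walk a b) (Avoids X)
  fromAvoid (here a∉) = nil _ , λ { (here refl) → a∉ }
  fromAvoid (step u∉ e w) with fromAvoid w
  ... | p , p-avoids = cons e p , λ { (here refl) → u∉ ; (there v∈) → p-avoids v∈ }

  toAvoid : ∀ {X a b} (p : Walk a b) → Avoids X p → WalkAvoid G X a b
  toAvoid (nil _)    p-avoids = here (p-avoids (here refl))
  toAvoid (cons e p) p-avoids = step (p-avoids (here refl)) e (toAvoid p (p-avoids ∘ there))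

  prefix : ∀ {a b z} (p : Walk a b) → z ∈ verts p → Σ (Walk a z) λ q → verts q ⊆ᴸ verts p
  prefix (nil _)    (here refl) = nil _ , λ x∈ → x∈
  prefix (cons e p) (here refl) = nil _ , λ { (here refl) → here refl }
  prefix (cons e p) (there z∈) with prefix p z∈
  ... | q , q⊆p = cons e q , λ { (here refl) → here refl ; (there x∈) → there (q⊆p x∈) }

  suffix : ∀ {a b z} (p : Walk a b) → Unique (verts p) → z ∈ verts p →
           Σ (Walk z b) λ q → Unique (verts q) × verts q ⊆ᴸ verts p
  suffix (nil _)    u (here refl) = nil _ , u , λ x∈ → x∈
  suffix (cons e p) u (here refl) = cons e p , u , λ x∈ → x∈
  suffix (cons e p) (_ ∷ u) (there z∈) with suffix p u z∈
  ... | q , uq , q⊆p = q , uq , there ∘ q⊆p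

-- Two facts about walks that need decidability of membership, hence excluded middle.
module ClassicalWalks (lem : ExcludedMiddle 0ℓ) (G : Graph) where
  open Graph G
  open Walks G

  toPath : ∀ {a b} (p : Walk a b) → Σ (Walk a b) λ q → Unique (verts q) × verts q ⊆ᴸ verts p
  toPath (nil v) = nil v , [] ∷ [] , λ x∈ → x∈
  toPath (cons {u} e p) with toPath p
  ... | q , q-path , q⊆p with lem {u ∈ verts q}
  ...   | yes u∈q with suffix q q-path u∈q
  ...     | r , r-path , r⊆q = r , r-path , there ∘ q⊆p ∘ r⊆q
  toPath (cons {u} e p) | q , q-path , q⊆p | no u∉q =
    cons e q , ¬Any⇒All¬ _ u∉q ∷ q-path ,
    λ { (here refl) → here refl ; (there x∈) → there (q⊆p x∈) }

  record FirstHit (R : List V) {a b} (p : Walk a b) : Set where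
    field
      hit       : V
      hit∈R     : hit ∈ R
      upToHit   : Walk a hit
      upToHit⊆p : verts upToHit ⊆ᴸ verts p
      onlyHit   : ∀ {x} → x ∈ verts upToHit → x ∈ R → x ≡ hit

  firstHit : ∀ (R : List V) {a b} (p : Walk a b) → b ∈ R → FirstHit R p
  firstHit R (nil v) v∈R = record
    { hit = v ; hit∈R = v∈R ; upToHit = nil v ; upToHit⊆p = λ x∈ → x∈
    ; onlyHit = λ { (here refl) _ → refl } }
  firstHit R (cons {a} e p) b∈R with lem {a ∈ R}
  ... | yes a∈R = record
    { hit = a ; hit∈R = a∈R ; upToHit = nil a ; upToHit⊆p = λ { (here refl) → here refl }
    ; onlyHit = λ { (here refl) _ → refl } }
  ... | no a∉R = record
    { hit = hit ; hit∈R = hit∈R ; upToHit = cons e upToHit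
    ; upToHit⊆p = λ { (here refl) → here refl ; (there x∈) → there (upToHit⊆p x∈) }
    ; onlyHit = λ { (here refl) a∈R → ⊥-elim (a∉R a∈R) ; (there x∈) → onlyHit x∈ } }
    where open FirstHit (firstHit R p b∈R)

module Rays (lem : ExcludedMiddle 0ℓ) (G : Graph) where
  open Graph G
  open Walks G

  TailAvoids : Ray G → ℕ → List V → Set
  TailAvoids r i X = ∀ k → i ≤ k → vert r k ∉ X

  -- a ray meets a finite set only finitely often, as it is injective
  eventuallyAvoids : (r : Ray G) (X : List V) → ∃ λ i → TailAvoids r i X
  eventuallyAvoids r [] = 0 , λ _ _ ()
  eventuallyAvoids r (x ∷ X) with eventuallyAvoids r X | lem {∃ λ k → vert r k ≡ x}
  ... | i , avoidsX | no x∉r =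
    i , λ { k i≤k (here eq) → x∉r (k , eq) ; k i≤k (there x∈) → avoidsX k i≤k x∈ }
  ... | i , avoidsX | yes (k₀ , rk₀≡x) = i + suc k₀ , avoids
    where
    avoids : TailAvoids r (i + suc k₀) (x ∷ X)
    avoids k le (here rk≡x) with inj r (trans rk≡x (sym rk₀≡x))
    ... | refl = 1+n≰n (≤-trans (m≤n+m (suc k) i) le)
    avoids k le (there x∈) = avoidsX k (≤-trans (m≤m+n i (suc k₀)) le) x∈

  segmentFrom : ∀ (r : Ray G) {X} i d → TailAvoids r i X →
                Σ (Walk (vert r i) (vert r (d + i))) (Avoids X)
  segmentFrom r i zero    avoids = nil _ , λ { (here refl) → avoids i ≤-refl }
  segmentFrom r i (suc d) avoids with segmentFrom r i d avoids
  ... | p , p-avoids = p ++w cons (adj r (d + i)) (nil _) ,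
    every-++w p _ p-avoids λ { (here refl)         → avoids (d + i) (m≤n+m i d)
                             ; (there (here refl)) → avoids (suc (d + i)) (m≤n+m i (suc d)) }

  raySegment : ∀ (r : Ray G) {X i j} → TailAvoids r i X → i ≤ j →
               Σ (Walk (vert r i) (vert r j)) (Avoids X)
  raySegment r {X} {i} {j} avoids i≤j =
    subst (λ k → Σ (Walk (vert r i) (vert r k)) (Avoids X)) (m∸n+n≡m i≤j)
          (segmentFrom r i (j ∸ i) avoids)

  missedMember : (L : ℕ → List V) → (∀ {n n' v} → v ∈ L n → v ∈ L n' → n ≡ n') →
                 ∀ X N → ∃ λ n → N ≤ n × (∀ {v} → v ∈ L n → v ∉ X)
  missedMember L disjoint [] N = N , ≤-refl , λ _ ()
  missedMember L disjoint (x ∷ X) N with missedMember L disjoint X N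
  ... | n , N≤n , missesX with lem {x ∈ L n}
  ...   | no x∉Ln = n , N≤n , λ { v∈ (here refl) → x∉Ln v∈ ; v∈ (there v∈X) → missesX v∈ v∈X }
  ...   | yes x∈Ln with missedMember L disjoint X (suc n)
  ...     | n' , n<n' , missesX' = n' , ≤-trans (n≤1+n N) (≤-trans (s≤s N≤n) n<n') , misses
    where
    misses : ∀ {v} → v ∈ L n' → v ∉ x ∷ X
    misses v∈ (here refl) with disjoint x∈Ln v∈
    ... | refl = 1+n≰n n<n'
    misses v∈ (there v∈X) = missesX' v∈ v∈X

  record Connector (r s : Ray G) (n : ℕ) : Set where
    field
      from to : ℕ
      n≤from  : n ≤ from
      n≤to    : n ≤ to
      end     : V
      end≡    : end ≡ vert s to
      walk    : Walk (vert r from) end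

  connected⇒equivalent : (r s : Ray G) (c : ∀ n → Connector r s n) →
    (∀ {n n' v} → v ∈ verts (Connector.walk (c n)) → v ∈ verts (Connector.walk (c n')) → n ≡ n') →
    Equiv G r s
  connected⇒equivalent r s c disjoint X with eventuallyAvoids r X | eventuallyAvoids s X
  ... | ir , r-avoids | is , s-avoids
    with missedMember (λ n → verts (Connector.walk (c n))) disjoint X (ir + is)
  ... | n , ir+is≤n , walk-avoids =
    from , to ,
    (λ k from≤k → r-avoids k (≤-trans (m≤m+n ir is) (≤-trans ir+is≤n (≤-trans n≤from from≤k)))) ,
    (λ k to≤k → s-avoids k (≤-trans (m≤n+m is ir) (≤-trans ir+is≤n (≤-trans n≤to to≤k)))) ,
    subst (WalkAvoid G X (vert r from)) end≡ (toAvoid walk walk-avoids)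
    where open Connector (c n)

  module Concatenation
    (P : V → Set) (a : ℕ → V) (F : ℕ → List V) (seg : ∀ n → Walk (a n) (a (suc n)))
    (F-grows      : ∀ n → F n ⊆ᴸ F (suc n))
    (seg-new      : ∀ n → Avoids (F n) (seg n))
    (seg-recorded : ∀ n → initv (seg n) ⊆ᴸ F (suc n))
    (seg-path     : ∀ n → Unique (verts (seg n)))
    (seg-moves    : ∀ n → ¬ a n ≡ a (suc n))
    (seg-in-P     : ∀ n → Every P (seg n))
    where

    -- the state of the traversal: the vertex `current`, the remainder `rest` of the segment
    -- ending in a index, and the list `visited` of vertices passed so far; the invariants
    -- say that the remainder is a path in P, unvisited so far, all recorded in F index
    record Position : Set where
      constructor position
      field
        index       : ℕ
        current     : V
        rest        : Walk current (a index)
        visited     : List V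
        visited⊆F   : visited ⊆ᴸ F index
        rest-init⊆F : initv rest ⊆ᴸ F index
        rest-path   : Unique (verts rest)
        rest-fresh  : Avoids visited rest
        rest-in-P   : Every P rest

    open Position

    takeEdge : ∀ {k u c} (e : u ~ c) (p : Walk c (a k)) (vis : List V) →
      vis ⊆ᴸ F k → initv (cons e p) ⊆ᴸ F k → Unique (verts (cons e p)) →
      Avoids vis (cons e p) → Every P (cons e p) → Position
    takeEdge {k} {u} {c} e p vis vis⊆F init⊆F path fresh in-P =
      position k c p (u ∷ vis) visited'⊆F (init⊆F ∘ there) (unique-tail path) fresh' (in-P ∘ there)
      where
      visited'⊆F : u ∷ vis ⊆ᴸ F k
      visited'⊆F (here refl)   = init⊆F (here refl)
      visited'⊆F (there x∈vis) = vis⊆F x∈vis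
      fresh' : Avoids (u ∷ vis) p
      fresh' x∈p (here refl)   = Unique[x∷xs]⇒x∉xs path x∈p
      fresh' x∈p (there x∈vis) = fresh (there x∈p) x∈vis

    record StepFrom (u : V) (vis : List V) (k : ℕ) : Set where
      field
        next         : Position
        edge         : u ~ current next
        visited-next : visited next ≡ u ∷ vis
        index-next   : index next ≡ k

    enter : ∀ {k u} (p : Walk u (a k)) → ¬ u ≡ a k → (vis : List V) →
      vis ⊆ᴸ F k → initv p ⊆ᴸ F k → Unique (verts p) → Avoids vis p → Every P p →
      StepFrom u vis k
    enter (nil _)    moves = ⊥-elim (moves refl)
    enter (cons e p) _     vis vis⊆F init⊆F path fresh in-P = record
      { next = takeEdge e p vis vis⊆F init⊆F path fresh in-P
      ; edge = e ; visited-next = refl ; index-next = refl }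

    record Move (s : Position) : Set where
      field
        next         : Position
        edge         : current s ~ current next
        visited-next : visited next ≡ current s ∷ visited s
        progress     : (len (rest s) ≡ 0 × index next ≡ suc (index s))
                     ⊎ (len (rest s) ≡ suc (len (rest next)) × index next ≡ index s)

    move : (s : Position) → Move s
    move (position n u (cons e p) vis vis⊆F init⊆F path fresh in-P) = record
      { next = takeEdge e p vis vis⊆F init⊆F path fresh in-P
      ; edge = e ; visited-next = refl ; progress = inj₂ (refl , refl) }
    move (position n _ (nil _) vis vis⊆F _ _ _ _) = record
      { next = next ; edge = edge ; visited-next = visited-next ; progress = inj₁ (refl , index-next) }
      where
      open StepFrom (enter (seg n) (seg-moves n) vis (F-grows n ∘ vis⊆F) (seg-recorded n)
                           (seg-path n) (λ x∈ x∈vis → seg-new n x∈ (vis⊆F x∈vis)) (seg-in-P n))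

    start : Position
    start = position 0 (a 0) (nil _) [] (λ ()) (λ ()) ([] ∷ []) (λ _ ())
                     (λ { (here refl) → seg-in-P 0 (start∈ (seg 0)) })

    pos : ℕ → Position
    pos zero    = start
    pos (suc t) = Move.next (move (pos t))

    -- the history only grows, so the ray never revisits a vertex
    visited-earlier : ∀ {i j} → i < j → current (pos i) ∈ visited (pos j)
    visited-earlier {i} {suc j} i<1+j rewrite Move.visited-next (move (pos j))
      with m<1+n⇒m<n∨m≡n i<1+j
    ... | inj₁ i<j  = there (visited-earlier i<j)
    ... | inj₂ refl = here refl

    current-unvisited : ∀ s → current s ∉ visited s
    current-unvisited s = rest-fresh s (start∈ (rest s))

    pos-injective : ∀ {i j} → current (pos i) ≡ current (pos j) → i ≡ j
    pos-injective {i} {j} eq with <-cmp i j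
    ... | tri< i<j _ _ = ⊥-elim (current-unvisited (pos j) (subst (_∈ _) eq (visited-earlier i<j)))
    ... | tri≈ _ i≡j _ = i≡j
    ... | tri> _ _ j<i = ⊥-elim (current-unvisited (pos i) (subst (_∈ _) (sym eq) (visited-earlier j<i)))

    ray : Ray G
    ray = record { vert = current ∘ pos ; inj = pos-injective ; adj = λ t → Move.edge (move (pos t)) }

    ray-in-P : ∀ t → P (vert ray t)
    ray-in-P t = rest-in-P (pos t) (start∈ (rest (pos t)))

    finishSegment : ∀ L t → len (rest (pos t)) ≡ L →
                    index (pos (L + t)) ≡ index (pos t) × len (rest (pos (L + t))) ≡ 0
    finishSegment zero    t remaining = refl , remaining
    finishSegment (suc L) t remaining with Move.progress (move (pos t))
    ... | inj₁ (finished , _) = ⊥-elim (0≢1+n (trans (sym finished) remaining))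
    ... | inj₂ (shorter , same-index)
      with finishSegment L (suc t) (suc-injective (trans (sym shorter) remaining))
    ... | index-kept , done = subst Finished (+-suc L t) (trans index-kept same-index , done)
      where
      Finished : ℕ → Set
      Finished k = index (pos k) ≡ index (pos t) × len (rest (pos k)) ≡ 0

    completes : ∀ n → ∃ λ t → n ≤ t × index (pos t) ≡ n × len (rest (pos t)) ≡ 0
    completes zero = 0 , z≤n , refl , refl
    completes (suc n) with completes n
    ... | t , n≤t , at-n , done with Move.progress (move (pos t))
    ... | inj₂ (shorter , _) = ⊥-elim (0≢1+n (trans (sym done) shorter))
    ... | inj₁ (_ , entered) with finishSegment (len (rest (pos (suc t)))) (suc t) refl
    ... | index-kept , done' =
      len (rest (pos (suc t))) + suc t , ≤-trans (s≤s n≤t) (m≤n+m (suc t) _) ,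
      trans index-kept (trans entered (cong suc at-n)) , done'

    passes : ∀ n → ∃ λ t → n ≤ t × vert ray t ≡ a n
    passes n with completes n
    ... | t , n≤t , at-n , done = t , n≤t , trans (len≡0 (rest (pos t)) done) (cong a at-n)

module TorsoShortcuts (lem : ExcludedMiddle 0ℓ) (G : Graph) (T : SepSet G) (tree : IsTreeSet G T)
                      (O : Orientation G T) (torso : TorsoIsInduced G T O) where
  open Graph G
  open SepSet T
  open Walks G

  Π : VSet G
  Π = Part G T O

  c : I → Sep G
  c = chosen G T O

  _⊑_ : Sep G → Sep G → Set
  _⊑_ = _≤ₛ_ G

  ⊑-chain : ∀ r s s' t → r ⊑ s → s ⊑ s' → s' ⊑ t → r ⊑ t
  ⊑-chain _ _ _ _ (A⊆ , B⊇) (A⊆' , B⊇') (A⊆'' , B⊇'') =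
    (λ v → A⊆'' v ∘ A⊆' v ∘ A⊆ v) , (λ v → B⊇ v ∘ B⊇' v ∘ B⊇'' v)

  ≈-refl : (s : Sep G) → _≈ₛ_ G s s
  ≈-refl _ = ((λ _ x → x) , (λ _ x → x)) , ((λ _ x → x) , (λ _ x → x))

  orientation-cases : ∀ i b → _≈ₛ_ G (orient G T i b) (c i) ⊎ _≈ₛ_ G (orient G T i b) (inv G (c i))
  orientation-cases i b with O i | b
  ... | true  | true  = inj₁ (≈-refl (sepOf i))
  ... | false | false = inj₁ (≈-refl (inv G (sepOf i)))
  ... | true  | false = inj₂ (≈-refl (inv G (sepOf i)))
  ... | false | true  = inj₂ (≈-refl (sepOf i))

  Nested : I → I → Set
  Nested i j = (c i ⊑ c j) ⊎ (inv G (c i) ⊑ inv G (c j)) ⊎ (c i ⊑ inv G (c j)) ⊎ (inv G (c i) ⊑ c j)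

  nested-via : ∀ {i j} s s' → s ⊑ s' →
               _≈ₛ_ G s (c i) ⊎ _≈ₛ_ G s (inv G (c i)) → _≈ₛ_ G s' (c j) ⊎ _≈ₛ_ G s' (inv G (c j)) →
               Nested i j
  nested-via {i} {j} s s' s⊑s' (inj₁ (_ , i≈)) (inj₁ (≈j , _)) =
    inj₁ (⊑-chain (c i) s s' (c j) i≈ s⊑s' ≈j)
  nested-via {i} {j} s s' s⊑s' (inj₂ (_ , i≈)) (inj₂ (≈j , _)) =
    inj₂ (inj₁ (⊑-chain (inv G (c i)) s s' (inv G (c j)) i≈ s⊑s' ≈j))
  nested-via {i} {j} s s' s⊑s' (inj₁ (_ , i≈)) (inj₂ (≈j , _)) =
    inj₂ (inj₂ (inj₁ (⊑-chain (c i) s s' (inv G (c j)) i≈ s⊑s' ≈j)))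
  nested-via {i} {j} s s' s⊑s' (inj₂ (_ , i≈)) (inj₁ (≈j , _)) =
    inj₂ (inj₂ (inj₂ (⊑-chain (inv G (c i)) s s' (c j) i≈ s⊑s' ≈j)))

  nested : ∀ i j → Nested i j
  nested i j with proj₁ tree i j
  ... | b , b' , i⊑j =
    nested-via (orient G T i b) (orient G T j b') i⊑j (orientation-cases i b) (orientation-cases j b')

  outsidePart : ∀ {w} → ¬ Π w → ∃ λ j → ¬ B (c j) w
  outsidePart {w} w∉Π with lem {∃ λ j → ¬ B (c j) w}
  ... | yes found = found
  ... | no none   = ⊥-elim (w∉Π λ j → em⇒dne lem λ w∉Bj → none (j , w∉Bj))

  separatorEdge : ∀ {u w} i → Π u → Π w → ¬ u ≡ w → A (c i) u → A (c i) w → u ~ w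
  separatorEdge {u} {w} i u∈Π w∈Π u≢w u∈A w∈A =
    proj₂ (proj₂ (proj₂ (torso u w) (u∈Π , w∈Π , inj₂ (u≢w , i , (u∈A , u∈Π i) , (w∈A , w∈Π i)))))

  -- y is u, or y lies strictly on the small side of a chosen separation whose small side holds u;
  -- this is how a walk leaving Π at u is confined until it returns to Π
  Linked : V → V → Set
  Linked u y = (y ≡ u) ⊎ ∃ λ i → A (c i) u × A (c i) y × ¬ B (c i) y

  linked-returns : ∀ {u y w} → Π u → Π w → Linked u y → y ~ w → (u ≡ w) ⊎ (u ~ w)
  linked-returns u∈Π w∈Π (inj₁ refl) e = inj₂ e
  linked-returns {u} {y} {w} u∈Π w∈Π (inj₂ (i , u∈A , y∈A , y∉B)) e with lem {A (c i) w} | lem {u ≡ w}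
  ... | no w∉A | _         = ⊥-elim (noEdge (c i) y∈A y∉B (w∈Π i) w∉A e)
  ... | yes _   | yes u≡w  = inj₁ u≡w
  ... | yes w∈A | no u≢w   = inj₂ (separatorEdge i u∈Π w∈Π u≢w u∈A w∈A)

  linked-continues : ∀ {u y w} → Π u → Linked u y → y ~ w → ¬ Π w → Linked u w
  linked-continues {u} {y} {w} u∈Π linked e w∉Π with outsidePart w∉Π
  ... | j , w∉B with cover (c j) w
  ...   | inj₂ w∈B = ⊥-elim (w∉B w∈B)
  ...   | inj₁ w∈A = continue linked
    where
    continue : Linked u y → Linked u w
    continue (inj₁ refl) with lem {A (c j) u}
    ... | yes u∈A = inj₂ (j , u∈A , w∈A , w∉B)
    ... | no u∉A  = ⊥-elim (noEdge (c j) w∈A w∉B (u∈Π j) u∉A (~-sym e))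
    continue (inj₂ (i , u∈A , y∈A , y∉B)) with nested i j
    ... | inj₁ (Ai⊆Aj , _)                 = inj₂ (j , Ai⊆Aj u u∈A , w∈A , w∉B)
    ... | inj₂ (inj₁ (Bi⊆Bj , Aj⊆Ai))      = inj₂ (i , u∈A , Aj⊆Ai w w∈A , λ w∈Bi → w∉B (Bi⊆Bj w w∈Bi))
    ... | inj₂ (inj₂ (inj₁ (Ai⊆Bj , Aj⊆Bi))) =
          ⊥-elim (noEdge (c j) w∈A w∉B (Ai⊆Bj y y∈A) (λ y∈Aj → y∉B (Aj⊆Bi y y∈Aj)) (~-sym e))
    ... | inj₂ (inj₂ (inj₂ (Bi⊆Aj , _)))   = inj₂ (j , Bi⊆Aj u (u∈Π i) , w∈A , w∉B)

  shortcutFrom : ∀ {u y v} → Π u → Π v → Linked u y → (p : Walk y v) →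
                 Σ (Walk u v) λ q → verts q ⊆ᴸ u ∷ verts p × Every Π q
  shortcutFrom u∈Π v∈Π (inj₁ refl) (nil _) = nil _ , there , λ { (here refl) → u∈Π }
  shortcutFrom u∈Π v∈Π (inj₂ (i , _ , _ , v∉B)) (nil _) = ⊥-elim (v∉B (v∈Π i))
  shortcutFrom {u} u∈Π v∈Π linked (cons {y} {w} e p) with lem {Π w}
  ... | no w∉Π with shortcutFrom u∈Π v∈Π (linked-continues u∈Π linked e w∉Π) p
  ...   | q , q⊆ , q∈Π = q , skip ∘ q⊆ , q∈Π
    where
    skip : u ∷ verts p ⊆ᴸ u ∷ y ∷ verts p
    skip (here refl) = here refl
    skip (there x∈)  = there (there x∈)
  shortcutFrom {u} u∈Π v∈Π linked (cons {y} {w} e p) | yes w∈Π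
    with shortcutFrom w∈Π v∈Π (inj₁ refl) p | linked-returns u∈Π w∈Π linked e
  ... | q , q⊆ , q∈Π | inj₁ refl = q , there ∘ there ∘ start∷⊆ p ∘ q⊆ , q∈Π
  ... | q , q⊆ , q∈Π | inj₂ u~w =
    cons u~w q , (λ { (here refl) → here refl ; (there x∈) → there (there (start∷⊆ p (q⊆ x∈))) }) ,
    λ { (here refl) → u∈Π ; (there x∈) → q∈Π x∈ }

  shortcut : ∀ {u v} → Π u → Π v → (p : Walk u v) → Σ (Walk u v) λ q → verts q ⊆ᴸ verts p × Every Π q
  shortcut u∈Π v∈Π p with shortcutFrom u∈Π v∈Π (inj₁ refl) p
  ... | q , q⊆ , q∈Π = q , start∷⊆ p ∘ q⊆ , q∈Π

module RayConstruction (lem : ExcludedMiddle 0ℓ) (G : Graph) (T : SepSet G) (tree : IsTreeSet G T)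
                       (O : Orientation G T) (torso : TorsoIsInduced G T O)
                       (ω : Ray G) (closure : InClosure G ω (Part G T O)) where
  open Graph G
  open Walks G
  open ClassicalWalks lem G
  open Rays lem G
  open TorsoShortcuts lem G T tree O torso

  record Stage : Set where
    field
      F           : List V
      x           : V
      x∈Π         : Π x
      m           : ℕ
      tail-avoids : TailAvoids ω m F
      W           : Walk (vert ω m) x
      W-avoids    : Avoids F W

  open Stage

  record Extension (S : Stage) : Set where
    field
      next       : Stage
      Q          : Walk (x S) (x next)
      Q-path     : Unique (verts Q)
      Q-in-Π     : Every Π Q
      Q-new      : Avoids (F S) Q
      Q-recorded : initv Q ⊆ᴸ F next
      F-grows    : F S ⊆ᴸ F next
      W-recorded : verts (W S) ⊆ᴸ F next
      m-grows    : m S < m next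

  initial : Stage
  initial with closure []
  ... | x₀ , x₀∈Π , m₀ , _ , W₀ =
    record { F = [] ; x = x₀ ; x∈Π = x₀∈Π ; m = m₀ ; tail-avoids = λ _ _ ()
           ; W = proj₁ (fromAvoid W₀) ; W-avoids = λ _ () }

  module Extend (S : Stage) where
    Y : List V
    Y = F S ++ verts (W S)

    reached : ∃[ v ] (Π v × InComp G Y ω v)
    reached = closure Y

    y : V
    y = proj₁ reached

    y∈Π : Π y
    y∈Π = proj₁ (proj₂ reached)

    m' : ℕ
    m' = proj₁ (proj₂ (proj₂ reached))

    tail'-avoids : TailAvoids ω m' Y
    tail'-avoids = proj₁ (proj₂ (proj₂ (proj₂ reached)))

    approach : Walk (vert ω m') y
    approach = proj₁ (fromAvoid (proj₂ (proj₂ (proj₂ (proj₂ reached)))))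

    approach-avoids : Avoids Y approach
    approach-avoids = proj₂ (fromAvoid (proj₂ (proj₂ (proj₂ (proj₂ reached)))))

    -- ω(m) lies on W, so the new tail starts later
    m<m' : m S < m'
    m<m' with m' ≤? m S
    ... | yes m'≤m = ⊥-elim (tail'-avoids (m S) m'≤m (∈-++⁺ʳ (F S) (start∈ (W S))))
    ... | no m'≰m  = ≰⇒> m'≰m

    along-ω : Σ (Walk (vert ω (m S)) (vert ω m')) (Avoids (F S))
    along-ω = raySegment ω (tail-avoids S) (<⇒≤ m<m')

    detour : Walk (x S) y
    detour = reverse (W S) ++w (proj₁ along-ω ++w approach)

    detour-avoids : Avoids (F S) detour
    detour-avoids =
      every-++w (reverse (W S)) _ (every-⊆ (verts-reverse (W S)) (W-avoids S))
        (every-++w (proj₁ along-ω) approach (proj₂ along-ω) (λ v∈ v∈F → approach-avoids v∈ (∈-++⁺ˡ v∈F)))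

    R : Walk (x S) y
    R = proj₁ (shortcut (x∈Π S) y∈Π detour)

    R⊆detour : verts R ⊆ᴸ verts detour
    R⊆detour = proj₁ (proj₂ (shortcut (x∈Π S) y∈Π detour))

    R-in-Π : Every Π R
    R-in-Π = proj₂ (proj₂ (shortcut (x∈Π S) y∈Π detour))

    M : ℕ
    M = proj₁ (eventuallyAvoids ω (verts R))

    m'' : ℕ
    m'' = M + m'

    along-ω' : Σ (Walk (vert ω m') (vert ω m'')) (Avoids Y)
    along-ω' = raySegment ω tail'-avoids (m≤n+m m' M)

    return : Walk (vert ω m'') y
    return = reverse (proj₁ along-ω') ++w approach

    return-avoids : Avoids Y return
    return-avoids =
      every-++w (reverse (proj₁ along-ω')) approach
        (every-⊆ (verts-reverse (proj₁ along-ω')) (proj₂ along-ω')) approach-avoids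

    open FirstHit (firstHit (verts R) return (end∈ R)) renaming (hit to z; hit∈R to z∈R)

    Q : Walk (x S) z
    Q = proj₁ (toPath (proj₁ (prefix R z∈R)))

    Q-path : Unique (verts Q)
    Q-path = proj₁ (proj₂ (toPath (proj₁ (prefix R z∈R))))

    Q⊆R : verts Q ⊆ᴸ verts R
    Q⊆R = proj₂ (prefix R z∈R) ∘ proj₂ (proj₂ (toPath (proj₁ (prefix R z∈R))))

    F' : List V
    F' = Y ++ initv Q

    upToHit-avoids : Avoids F' upToHit
    upToHit-avoids = avoids-++ (every-⊆ upToHit⊆p return-avoids) λ v∈ v∈Q →
      end∉initv Q Q-path (subst (_∈ initv Q) (onlyHit v∈ (Q⊆R (initv⊆verts Q v∈Q))) v∈Q)

    tail''-avoids : TailAvoids ω m'' F'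
    tail''-avoids k m''≤k ωk∈F' =
      [ tail'-avoids k (≤-trans (m≤n+m m' M) m''≤k)
      , proj₂ (eventuallyAvoids ω (verts R)) k (≤-trans (m≤m+n M m') m''≤k) ∘ Q⊆R ∘ initv⊆verts Q
      ]′ (∈-++⁻ Y ωk∈F')

    extension : Extension S
    extension = record
      { next = record { F = F' ; x = z ; x∈Π = R-in-Π z∈R ; m = m'' ; tail-avoids = tail''-avoids
                      ; W = upToHit ; W-avoids = upToHit-avoids }
      ; Q = Q ; Q-path = Q-path ; Q-in-Π = R-in-Π ∘ Q⊆R
      ; Q-new = every-⊆ (R⊆detour ∘ Q⊆R) detour-avoids
      ; Q-recorded = ∈-++⁺ʳ Y
      ; F-grows = ∈-++⁺ˡ ∘ ∈-++⁺ˡ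
      ; W-recorded = ∈-++⁺ˡ ∘ ∈-++⁺ʳ (F S)
      ; m-grows = ≤-trans m<m' (m≤n+m m' M) }

  stage : ℕ → Stage
  stage zero    = initial
  stage (suc n) = Extension.next (Extend.extension (stage n))

  module Step (n : ℕ) = Extension (Extend.extension (stage n))

  W-recorded-later : ∀ {n n'} → n < n' → verts (W (stage n)) ⊆ᴸ F (stage n')
  W-recorded-later {n} n<n' = increasing-⊆ (F ∘ stage) Step.F-grows (≤⇒≤′ n<n') ∘ Step.W-recorded n

  W-disjoint : ∀ {n n' v} → v ∈ verts (W (stage n)) → v ∈ verts (W (stage n')) → n ≡ n'
  W-disjoint {n} {n'} v∈Wn v∈Wn' with <-cmp n n'
  ... | tri< n<n' _ _ = ⊥-elim (W-avoids (stage n') v∈Wn' (W-recorded-later n<n' v∈Wn))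
  ... | tri≈ _ n≡n' _ = n≡n'
  ... | tri> _ _ n'<n = ⊥-elim (W-avoids (stage n) v∈Wn (W-recorded-later n'<n v∈Wn'))

  -- consecutive ends differ: x of a stage is recorded in the next, whose own x is not
  moves : ∀ n → ¬ x (stage n) ≡ x (stage (suc n))
  moves n eq = W-avoids (stage (suc n)) (end∈ (W (stage (suc n))))
                 (subst (_∈ F (stage (suc n))) eq (Step.W-recorded n (end∈ (W (stage n)))))

  open Concatenation Π (x ∘ stage) (F ∘ stage) Step.Q Step.F-grows Step.Q-new Step.Q-recorded
                     Step.Q-path moves Step.Q-in-Π
    using (ray; ray-in-P; passes)

  connector : ∀ n → Connector ω ray n
  connector n = record
    { from = m (stage n) ; to = proj₁ (passes n)
    ; n≤from = strictly-increasing (m ∘ stage) Step.m-grows n ; n≤to = proj₁ (proj₂ (passes n))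
    ; end = x (stage n) ; end≡ = sym (proj₂ (proj₂ (passes n))) ; walk = W (stage n) }

  ray-inside : HasRayIn G ω Π
  ray-inside = ray , connected⇒equivalent ω ray connector W-disjoint , ray-in-P

corollary2p4 : ExcludedMiddle 0ℓ →
    (G : Graph) → Connected G →
    (T : SepSet G) → IsTreeSet G T →
    (O : Orientation G T) → Consistent G T O →
    TorsoIsInduced G T O →
    (ω : Ray G) → InClosure G ω (Part G T O) →
    HasRayIn G ω (Part G T O)
corollary2p4 lem G _ T tree O _ torso ω closure =
  RayConstruction.ray-inside lem G T tree O torso ω closure
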